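{- Let $r\ge 2$ and $1\le t\le r-1$ be integers, let $m=2r-2+t$ and $\ell=\lfloor \frac{r-1}{t}\rfloor+1$. Then there is a constant $c>0$ depending only on $r$ and $t$ such that every graph $G$ on $n$ vertices with $\alpha_m(G)\ge r$ satisfies $\alpha(G)\ge c\, n^{1-1/\ell}$.
   Context: For a graph $G$, $\alpha(G)$ denotes its independence number. For an integer $m$, the $m$-local independence number $\alpha_m(G)$ is the minimum of $\alpha(G[S])$ over all $m$-element vertex subsets $S$ of $G$; thus $\alpha_m(G)\ge r$ means that every set of $m$ vertices of $G$ contains an independent set of size $r$. -}

module Defs where

open import Data.Nat using (ℕ; zero; suc; _+_; _*_; _∸_; _^_; _≤_; _<_)
open import Data.Nat.DivMod using (_/_)
open import Data.Bool using (Bool; true; false)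
open import Data.Fin using (Fin)
open import Data.Fin.Subset using (Subset; _∈_; _⊆_; ∣_∣)
open import Data.Product using (Σ; _×_)
open import Relation.Binary.PropositionalEquality using (_≡_)

record Graph (n : ℕ) : Set where
  field
    adj    : Fin n → Fin n → Bool
    sym    : ∀ x y → adj x y ≡ adj y x
    irrefl : ∀ x → adj x x ≡ false
open Graph public

Independent : ∀ {n} → Graph n → Subset n → Set
Independent G S = ∀ {x y} → x ∈ S → y ∈ S → adj G x y ≡ false

αAtLeast : ∀ {n} → Graph n → ℕ → Set
αAtLeast {n} G k = Σ (Subset n) λ I → Independent G I × ∣ I ∣ ≡ k

LocalαAtLeast : ∀ {n} → Graph n → (m r : ℕ) → Set
LocalαAtLeast {n} G m r =
  ∀ (S : Subset n) → ∣ S ∣ ≡ m →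
    Σ (Subset n) λ I → I ⊆ S × Independent G I × ∣ I ∣ ≡ r

-- ℓ = ⌊(r-1)/t⌋ + 1   (only used for t ≥ 1; value at t = 0 is irrelevant)
ell : ℕ → ℕ → ℕ
ell r zero    = 0
ell r (suc t) = (r ∸ 1) / suc t + 1

-- Below r = q + 1 and k = ℓ - 1 = ⌊q/t⌋.
--
-- All arguments happen inside a host vertex set W, which is called
-- (m, r)-local when each m-subset of W contains an independent r-set.
-- The basic tool is the removal lemma: deleting an h-set of independence
-- number ≤ j from an (h+m, j+r)-local set leaves an (m, r)-local set.
-- * Matching: a (2q, q+1)-local W has an independent I with ∣W∣ ≤ ∣I∣ + 2q
--   (delete the edges one at a time).
-- * Odd paths: two vertices of one breadth-first layer are joined through
--   earlier layers by a path on 2p+1 vertices; if they are adjacent this is an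
--   odd cycle Q with α(Q) ≤ p.  Deleting it and matching the rest gives an
--   independent I with ∣W∣ ≤ ∣I∣ + 2q + 1 in a (2q+1, q+1)-local W.
-- * Case t = 1: grow breadth-first layers while each is D times larger than
--   the previous one.  Either a layer of size ≥ D^k is independent, or an
--   independent layer L is followed by a thin layer; then L ∪ (recursive
--   solution in W minus the ball) is independent and the ball has at most
--   2D ∣L∣ vertices.  Choosing D = ⌊∣W∣^(1/(k+1))⌋ yields ∣W∣^k ≤ K ∣I∣^(k+1).
-- * Induction on t: either W has a (t-1+2j)-subset of independence number
--   ≤ j (where q = k + j), whose removal leaves a (2k+1, k+1)-local set, or W
--   is (t-1+2j, j+1)-local and the induction hypothesis applies.

module Submission where

open import Defs hiding (sym)
open import Data.Bool using (true; false)
open import Data.Bool.Properties using (¬-not; _≟_)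
open import Data.Empty using () renaming (⊥-elim to absurd)
open import Data.Fin using (Fin; zero; suc) renaming (_≟_ to _≟ᶠ_)
open import Data.Fin.Properties using (any?)
open import Data.Fin.Subset
open import Data.Fin.Subset.Properties
open import Data.Nat using (ℕ; zero; suc; _+_; _*_; _∸_; _^_; _≤_; _<_; z≤n; s≤s; _≤?_; _<?_; >-nonZero)
  renaming (_≟_ to _≟ℕ_)
open import Data.Nat.DivMod using (_/_; m/n*n≤m; m≥n⇒m/n>0)
open import Data.Nat.Induction using (<-rec)
open import Data.Nat.Properties hiding (_≟_)
open import Data.Nat.Tactic.RingSolver using (solve-∀)
open import Data.Product using (Σ; _×_; _,_)
open import Data.Sum using (_⊎_; inj₁; inj₂; [_,_]′)
open import Data.Vec using (_∷_; []; here; there; tabulate)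
open import Data.Vec.Properties using (lookup∘tabulate; lookup⇒[]=; []=⇒lookup)
open import Function using (case_of_; id)
open import Level using (0ℓ)
open import Relation.Binary.PropositionalEquality
open import Relation.Nullary using (¬_; Dec; yes; no; does)
open import Relation.Nullary.Decidable using (dec-true; _×-dec_)
open import Relation.Unary using (Pred; Decidable)

2+[a+[q+q]]≡a+[1+q+1+q] : ∀ a q → 2 + (a + (q + q)) ≡ a + (suc q + suc q)
2+[a+[q+q]]≡a+[1+q+1+q] = solve-∀

1+[p+p]+2≡1+[1+p+1+p] : ∀ p → suc (p + p) + 2 ≡ suc (suc p + suc p)
1+[p+p]+2≡1+[1+p+1+p] = solve-∀

1+[p+d+[p+d]]≡1+[p+p]+[d+d] : ∀ p d → suc ((p + d) + (p + d)) ≡ suc (p + p) + (d + d)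
1+[p+d+[p+d]]≡1+[p+p]+[d+d] = solve-∀

1+[p+p]+[a+[d+d]]≡a+1+[p+d+[p+d]] : ∀ p d a → suc (p + p) + (a + (d + d)) ≡ a + suc ((p + d) + (p + d))
1+[p+p]+[a+[d+d]]≡a+1+[p+d+[p+d]] = solve-∀

2+t+[2[k+j]]≡1+t+2j+[1+2k] : ∀ t k j →
  suc (suc t) + ((k + j) + (k + j)) ≡ (suc t + (j + j)) + suc (k + k)
2+t+[2[k+j]]≡1+t+2j+[1+2k] = solve-∀

1+[k+j]≡j+[1+k] : ∀ k j → suc (k + j) ≡ j + suc k
1+[k+j]≡j+[1+k] = solve-∀

2*[1+q]≡2+[q+q] : ∀ q → 2 * suc q ≡ suc (suc (q + q))
2*[1+q]≡2+[q+q] = solve-∀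

m+m≤D*m : ∀ {D} → 2 ≤ D → ∀ m → m + m ≤ D * m
m+m≤D*m 2≤D m = ≤-trans (≤-reflexive (cong (m +_) (sym (+-identityʳ m)))) (*-monoˡ-≤ m 2≤D)

m≤[D+D]*m : ∀ {D} → 2 ≤ D → ∀ m → m ≤ (D + D) * m
m≤[D+D]*m {D} 2≤D m =
  ≤-trans (m≤m+n m m) (≤-trans (m+m≤D*m 2≤D m) (*-monoˡ-≤ m (m≤m+n D D)))

Disjoint : ∀ {n} → Subset n → Subset n → Set
Disjoint p q = ∀ {x} → x ∈ p → x ∉ q

x∈p─q⇒x∉q : ∀ {n} {x : Fin n} (p q : Subset n) → x ∈ p ─ q → x ∉ q
x∈p─q⇒x∉q (inside ∷ p) (outside ∷ q) here      ()
x∈p─q⇒x∉q (s ∷ p)      (t ∷ q)       (there m) (there k) = x∈p─q⇒x∉q p q m k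

∣p∣≡∣p∩q∣+∣p─q∣ : ∀ {n} (p q : Subset n) → ∣ p ∣ ≡ ∣ p ∩ q ∣ + ∣ p ─ q ∣
∣p∣≡∣p∩q∣+∣p─q∣ []            []            = refl
∣p∣≡∣p∩q∣+∣p─q∣ (inside ∷ p)  (inside ∷ q)  = cong suc (∣p∣≡∣p∩q∣+∣p─q∣ p q)
∣p∣≡∣p∩q∣+∣p─q∣ (inside ∷ p)  (outside ∷ q) =
  trans (cong suc (∣p∣≡∣p∩q∣+∣p─q∣ p q)) (sym (+-suc _ _))
∣p∣≡∣p∩q∣+∣p─q∣ (outside ∷ p) (inside ∷ q)  = ∣p∣≡∣p∩q∣+∣p─q∣ p q
∣p∣≡∣p∩q∣+∣p─q∣ (outside ∷ p) (outside ∷ q) = ∣p∣≡∣p∩q∣+∣p─q∣ p q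

∣p∪q∣≡∣p∣+∣q∣ : ∀ {n} (p q : Subset n) → Disjoint p q → ∣ p ∪ q ∣ ≡ ∣ p ∣ + ∣ q ∣
∣p∪q∣≡∣p∣+∣q∣ []            []            _ = refl
∣p∪q∣≡∣p∣+∣q∣ (inside ∷ p)  (inside ∷ q)  d = absurd (d here here)
∣p∪q∣≡∣p∣+∣q∣ (inside ∷ p)  (outside ∷ q) d =
  cong suc (∣p∪q∣≡∣p∣+∣q∣ p q (λ a b → d (there a) (there b)))
∣p∪q∣≡∣p∣+∣q∣ (outside ∷ p) (inside ∷ q)  d =
  trans (cong suc (∣p∪q∣≡∣p∣+∣q∣ p q (λ a b → d (there a) (there b)))) (sym (+-suc _ _))
∣p∪q∣≡∣p∣+∣q∣ (outside ∷ p) (outside ∷ q) d = ∣p∪q∣≡∣p∣+∣q∣ p q (λ a b → d (there a) (there b))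

split-≤ : ∀ {n} (p q : Subset n) {a b} → ∣ p ∩ q ∣ ≤ a → ∣ p ─ q ∣ ≤ b → ∣ p ∣ ≤ a + b
split-≤ p q ∣p∩q∣≤a ∣p─q∣≤b =
  ≤-trans (≤-reflexive (∣p∣≡∣p∩q∣+∣p─q∣ p q)) (+-mono-≤ ∣p∩q∣≤a ∣p─q∣≤b)

∣p∣≡∣q∣+∣p─q∣ : ∀ {n} {p q : Subset n} → q ⊆ p → ∣ p ∣ ≡ ∣ q ∣ + ∣ p ─ q ∣
∣p∣≡∣q∣+∣p─q∣ {p = p} {q} q⊆p =
  trans (∣p∣≡∣p∩q∣+∣p─q∣ p q) (cong (λ s → ∣ s ∣ + ∣ p ─ q ∣) p∩q≡q)
  where
    p∩q≡q : p ∩ q ≡ q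
    p∩q≡q = ⊆-antisym (p∩q⊆q p q) (λ x∈q → x∈p∩q⁺ (q⊆p x∈q , x∈q))

⊆∪-avoidʳ : ∀ {n} {s p q : Subset n} → s ⊆ p ∪ q → Disjoint s q → s ⊆ p
⊆∪-avoidʳ {p = p} {q} s⊆p∪q d x∈s with x∈p∪q⁻ p q (s⊆p∪q x∈s)
... | inj₁ x∈p = x∈p
... | inj₂ x∈q = absurd (d x∈s x∈q)

⊆∪-avoidˡ : ∀ {n} {s p q : Subset n} → s ⊆ p ∪ q → Disjoint s p → s ⊆ q
⊆∪-avoidˡ {p = p} {q} s⊆p∪q d x∈s with x∈p∪q⁻ p q (s⊆p∪q x∈s)
... | inj₁ x∈p = absurd (d x∈s x∈p)
... | inj₂ x∈q = x∈q

∉⇒Disjoint⁅⁆ : ∀ {n} {s : Subset n} {x} → x ∉ s → Disjoint s ⁅ x ⁆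
∉⇒Disjoint⁅⁆ {x = x} x∉s y∈s y∈⁅x⁆ = x∉s (subst (_∈ _) (x∈⁅y⁆⇒x≡y x y∈⁅x⁆) y∈s)

Disjoint-∪ : ∀ {n} {s p q : Subset n} → Disjoint s p → Disjoint s q → Disjoint s (p ∪ q)
Disjoint-∪ {p = p} {q} s∩p=∅ s∩q=∅ x∈s x∈p∪q with x∈p∪q⁻ p q x∈p∪q
... | inj₁ x∈p = s∩p=∅ x∈s x∈p
... | inj₂ x∈q = s∩q=∅ x∈s x∈q

∣p∣≤1 : ∀ {n} {p : Subset n} {x} → p ⊆ ⁅ x ⁆ → ∣ p ∣ ≤ 1
∣p∣≤1 {x = x} p⊆⁅x⁆ = ≤-trans (p⊆q⇒∣p∣≤∣q∣ p⊆⁅x⁆) (≤-reflexive (∣⁅x⁆∣≡1 x))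

∣Empty∣≡0 : ∀ {n} {p : Subset n} → Empty p → ∣ p ∣ ≡ 0
∣Empty∣≡0 {n} e = trans (cong ∣_∣ (Empty-unique e)) (∣⊥∣≡0 n)

∪-lub : ∀ {n} {p q r : Subset n} → p ⊆ r → q ⊆ r → p ∪ q ⊆ r
∪-lub {p = p} {q} p⊆r q⊆r x∈p∪q with x∈p∪q⁻ p q x∈p∪q
... | inj₁ x∈p = p⊆r x∈p
... | inj₂ x∈q = q⊆r x∈q

⁅⁆⊆ : ∀ {n} {x : Fin n} {W} → x ∈ W → ⁅ x ⁆ ⊆ W
⁅⁆⊆ {x = x} {W} x∈W y∈⁅x⁆ = subst (_∈ W) (sym (x∈⁅y⁆⇒x≡y x y∈⁅x⁆)) x∈W

pair : ∀ {n} → Fin n → Fin n → Subset n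
pair x y = ⁅ x ⁆ ∪ ⁅ y ⁆

∣pair∣≡2 : ∀ {n} {x y : Fin n} → x ≢ y → ∣ pair x y ∣ ≡ 2
∣pair∣≡2 {x = x} {y} x≢y =
  trans (∣p∪q∣≡∣p∣+∣q∣ ⁅ x ⁆ ⁅ y ⁆ distinct) (cong₂ _+_ (∣⁅x⁆∣≡1 x) (∣⁅x⁆∣≡1 y))
  where
    distinct : Disjoint ⁅ x ⁆ ⁅ y ⁆
    distinct z∈⁅x⁆ z∈⁅y⁆ = x≢y (trans (sym (x∈⁅y⁆⇒x≡y x z∈⁅x⁆)) (x∈⁅y⁆⇒x≡y y z∈⁅y⁆))

pair⊆ : ∀ {n} {x y : Fin n} {W} → x ∈ W → y ∈ W → pair x y ⊆ W
pair⊆ x∈W y∈W = ∪-lub (⁅⁆⊆ x∈W) (⁅⁆⊆ y∈W)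

⟦_⟧ : ∀ {n} {P : Pred (Fin n) 0ℓ} → Decidable P → Subset n
⟦ P? ⟧ = tabulate (λ x → does (P? x))

∈⟦⟧⁺ : ∀ {n} {P : Pred (Fin n) 0ℓ} (P? : Decidable P) {x} → P x → x ∈ ⟦ P? ⟧
∈⟦⟧⁺ P? {x} px = lookup⇒[]= x _ (trans (lookup∘tabulate _ x) (dec-true (P? x) px))

∈⟦⟧⁻ : ∀ {n} {P : Pred (Fin n) 0ℓ} (P? : Decidable P) {x} → x ∈ ⟦ P? ⟧ → P x
∈⟦⟧⁻ P? {x} x∈P with P? x | trans (sym (lookup∘tabulate (λ z → does (P? z)) x)) ([]=⇒lookup x∈P)
... | yes px | _  = px
... | no _   | ()

module _ {n : ℕ} (G : Graph n) where

  adj⇒≢ : ∀ {x y} → adj G x y ≡ true → x ≢ y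
  adj⇒≢ {x} xy refl with () ← trans (sym xy) (irrefl G x)

  independent-⊥ : Independent G ⊥
  independent-⊥ x∈⊥ = absurd (∉⊥ x∈⊥)

  independent-⁅⁆ : ∀ v → Independent G ⁅ v ⁆
  independent-⁅⁆ v x∈⁅v⁆ y∈⁅v⁆
    rewrite x∈⁅y⁆⇒x≡y v x∈⁅v⁆ | x∈⁅y⁆⇒x≡y v y∈⁅v⁆ = irrefl G v

  independent-⊆ : ∀ {I J} → I ⊆ J → Independent G J → Independent G I
  independent-⊆ I⊆J indJ x∈I y∈I = indJ (I⊆J x∈I) (I⊆J y∈I)

  adjacent-excluded : ∀ {I x y} → Independent G I → adj G x y ≡ true → x ∈ I → y ∉ I
  adjacent-excluded indI xy x∈I y∈I with () ← trans (sym xy) (indI x∈I y∈I)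

  independent-∪ : ∀ {I J} → Independent G I → Independent G J →
                  (∀ {x y} → x ∈ I → y ∈ J → adj G x y ≡ false) → Independent G (I ∪ J)
  independent-∪ {I} {J} indI indJ cross {x} {y} x∈I∪J y∈I∪J
    with x∈p∪q⁻ I J x∈I∪J | x∈p∪q⁻ I J y∈I∪J
  ... | inj₁ x∈I | inj₁ y∈I = indI x∈I y∈I
  ... | inj₁ x∈I | inj₂ y∈J = cross x∈I y∈J
  ... | inj₂ x∈J | inj₁ y∈I = trans (Graph.sym G x y) (cross y∈I x∈J)
  ... | inj₂ x∈J | inj₂ y∈J = indJ x∈J y∈J

  Edge : Subset n → Set
  Edge S = Σ (Fin n) λ x → Σ (Fin n) λ y → x ∈ S × y ∈ S × adj G x y ≡ true

  independent-or-edge : ∀ S → Independent G S ⊎ Edge S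
  independent-or-edge S
    with any? (λ x → any? (λ y → (x ∈? S) ×-dec ((y ∈? S) ×-dec (adj G x y ≟ true))))
  ... | yes edge  = inj₂ edge
  ... | no noEdge = inj₁ λ {x} {y} x∈S y∈S → ¬-not (λ xy → noEdge (x , y , x∈S , y∈S , xy))

  independent? : ∀ S → Dec (Independent G S)
  independent? S with independent-or-edge S
  ... | inj₁ indS                       = yes indS
  ... | inj₂ (x , y , x∈S , y∈S , xy) = no λ indS → adjacent-excluded indS xy x∈S y∈S

  AlphaAtMost : Subset n → ℕ → Set
  AlphaAtMost H j = ∀ {I} → I ⊆ H → Independent G I → ∣ I ∣ ≤ j

  Local : Subset n → ℕ → ℕ → Set
  Local W m r = ∀ {S} → S ⊆ W → ∣ S ∣ ≡ m →
                Σ (Subset n) λ I → I ⊆ S × Independent G I × r ≤ ∣ I ∣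

  local-⊆ : ∀ {W W′ m r} → W′ ⊆ W → Local W m r → Local W′ m r
  local-⊆ W′⊆W P S⊆W′ = P (λ x∈S → W′⊆W (S⊆W′ x∈S))

  -- Removal lemma: deleting an h-set H with α(H) ≤ j from an
  -- (h+m, j+r)-local set leaves an (m, r)-local set, because an independent
  -- (j+r)-set inside S ∪ H has at least r vertices outside H.
  local-─ : ∀ {W H h m j r} → Local W (h + m) (j + r) → H ⊆ W → ∣ H ∣ ≡ h →
            AlphaAtMost H j → Local (W ─ H) m r
  local-─ {W} {H} {h} {m} {j} {r} P H⊆W ∣H∣≡h αH≤j {S} S⊆W─H ∣S∣≡m
    with P (∪-lub (λ x∈S → p─q⊆p W H (S⊆W─H x∈S)) H⊆W) ∣S∪H∣≡h+m
    where
      ∣S∪H∣≡h+m : ∣ S ∪ H ∣ ≡ h + m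
      ∣S∪H∣≡h+m = begin
        ∣ S ∪ H ∣     ≡⟨ ∣p∪q∣≡∣p∣+∣q∣ S H (λ x∈S → x∈p─q⇒x∉q W H (S⊆W─H x∈S)) ⟩
        ∣ S ∣ + ∣ H ∣ ≡⟨ cong₂ _+_ ∣S∣≡m ∣H∣≡h ⟩
        m + h         ≡⟨ +-comm m h ⟩
        h + m         ∎
        where open ≡-Reasoning
  ... | I , I⊆S∪H , indI , j+r≤∣I∣ =
    I ─ H , I─H⊆S , independent-⊆ (p─q⊆p I H) indI , +-cancelˡ-≤ j r ∣ I ─ H ∣ j+r≤j+∣I─H∣
    where
      I─H⊆S : I ─ H ⊆ S
      I─H⊆S = ⊆∪-avoidʳ (λ x∈I─H → I⊆S∪H (p─q⊆p I H x∈I─H)) (x∈p─q⇒x∉q I H)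
      j+r≤j+∣I─H∣ : j + r ≤ j + ∣ I ─ H ∣
      j+r≤j+∣I─H∣ = begin
        j + r                     ≤⟨ j+r≤∣I∣ ⟩
        ∣ I ∣                     ≡⟨ ∣p∣≡∣p∩q∣+∣p─q∣ I H ⟩
        ∣ I ∩ H ∣ + ∣ I ─ H ∣     ≤⟨ +-monoˡ-≤ ∣ I ─ H ∣ (αH≤j (p∩q⊆q I H)
                                                         (independent-⊆ (p∩q⊆p I H) indI)) ⟩
        j + ∣ I ─ H ∣             ∎
        where open ≤-Reasoning

  pair-α : ∀ {x y} → adj G x y ≡ true → AlphaAtMost (pair x y) 1
  pair-α {x} {y} xy {I} I⊆xy indI with x ∈? I
  ... | no  x∉I = ∣p∣≤1 (⊆∪-avoidˡ I⊆xy (∉⇒Disjoint⁅⁆ x∉I))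
  ... | yes x∈I = ∣p∣≤1 (⊆∪-avoidʳ I⊆xy (∉⇒Disjoint⁅⁆ (adjacent-excluded indI xy x∈I)))

  -- Matching lemma: in a (2q, q+1)-local W some independent I misses at
  -- most 2q vertices.  While W spans an edge, delete it (removal lemma with
  -- h = 2, j = 1) and recurse with q - 1.
  matching : ∀ q {W} → Local W (q + q) (suc q) →
             Σ (Subset n) λ I → I ⊆ W × Independent G I × ∣ W ∣ ≤ ∣ I ∣ + (q + q)
  matching zero {W} P with P (⊆-min W) (∣⊥∣≡0 n)
  ... | I , I⊆⊥ , _ , 1≤∣I∣ =
    absurd (<⇒≱ 1≤∣I∣ (≤-trans (p⊆q⇒∣p∣≤∣q∣ I⊆⊥) (≤-reflexive (∣⊥∣≡0 n))))
  matching (suc q) {W} P with independent-or-edge W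
  ... | inj₁ indW = W , ⊆-refl , indW , m≤m+n ∣ W ∣ _
  ... | inj₂ (x , y , x∈W , y∈W , xy)
    with matching q (local-─ P′ (pair⊆ x∈W y∈W) (∣pair∣≡2 (adj⇒≢ xy)) (pair-α xy))
    where
      P′ : Local W (2 + (q + q)) (1 + suc q)
      P′ = subst (λ m → Local W m (suc (suc q))) (cong suc (+-suc q q)) P
  ... | I , I⊆W─H , indI , ∣W─H∣≤ = I , (λ z∈I → p─q⊆p W _ (I⊆W─H z∈I)) , indI , ∣W∣≤
    where
      ∣W∣≤ : ∣ W ∣ ≤ ∣ I ∣ + (suc q + suc q)
      ∣W∣≤ = begin
        ∣ W ∣                          ≡⟨ ∣p∣≡∣q∣+∣p─q∣ (pair⊆ x∈W y∈W) ⟩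
        ∣ pair x y ∣ + ∣ W ─ pair x y ∣ ≡⟨ cong (_+ ∣ W ─ pair x y ∣) (∣pair∣≡2 (adj⇒≢ xy)) ⟩
        2 + ∣ W ─ pair x y ∣           ≤⟨ +-monoʳ-≤ 2 ∣W─H∣≤ ⟩
        2 + (∣ I ∣ + (q + q))           ≡⟨ 2+[a+[q+q]]≡a+[1+q+1+q] ∣ I ∣ q ⟩
        ∣ I ∣ + (suc q + suc q)         ∎
        where open ≤-Reasoning

  alpha-dichotomy : ∀ H j → AlphaAtMost H j ⊎ Σ (Subset n) λ I → I ⊆ H × Independent G I × j < ∣ I ∣
  alpha-dichotomy H j with anySubset? (λ I → I ⊆? H ×-dec (independent? I ×-dec (j <? ∣ I ∣)))
  ... | yes big   = inj₂ big
  ... | no  noBig = inj₁ λ {I} I⊆H indI → ≮⇒≥ (λ j<∣I∣ → noBig (I , I⊆H , indI , j<∣I∣))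

  alphaAtMost? : ∀ H j → Dec (AlphaAtMost H j)
  alphaAtMost? H j with alpha-dichotomy H j
  ... | inj₁ αH≤j                     = yes αH≤j
  ... | inj₂ (I , I⊆H , indI , j<∣I∣) = no λ αH≤j → <⇒≱ j<∣I∣ (αH≤j I⊆H indI)

  sparse-set-or-local : ∀ W h j →
    (Σ (Subset n) λ H → H ⊆ W × ∣ H ∣ ≡ h × AlphaAtMost H j) ⊎ Local W h (suc j)
  sparse-set-or-local W h j
    with anySubset? (λ H → H ⊆? W ×-dec ((∣ H ∣ ≟ℕ h) ×-dec alphaAtMost? H j))
  ... | yes sparse   = inj₁ sparse
  ... | no  noSparse = inj₂ λ {S} S⊆W ∣S∣≡h → case alpha-dichotomy S j of λ where
    (inj₁ αS≤j) → absurd (noSparse (S , S⊆W , ∣S∣≡h , αS≤j))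
    (inj₂ big)  → big

  delete-and-match : ∀ {q p W Q} → Local W (suc (q + q)) (suc q) → Q ⊆ W →
    ∣ Q ∣ ≡ suc (p + p) → AlphaAtMost Q p → p ≤ q →
    Σ (Subset n) λ I → I ⊆ W × Independent G I × ∣ W ∣ ≤ ∣ I ∣ + suc (q + q)
  delete-and-match {p = p} {W} {Q} P Q⊆W ∣Q∣≡1+2p αQ≤p p≤q with m≤n⇒∃[o]m+o≡n p≤q
  ... | d , refl
    with matching d (local-─ (subst₂ (Local W) (1+[p+d+[p+d]]≡1+[p+p]+[d+d] p d) (sym (+-suc p d)) P)
                             Q⊆W ∣Q∣≡1+2p αQ≤p)
  ... | I , I⊆W─Q , indI , ∣W─Q∣≤ = I , (λ x∈I → p─q⊆p W Q (I⊆W─Q x∈I)) , indI , ∣W∣≤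
    where
      ∣W∣≤ : ∣ W ∣ ≤ ∣ I ∣ + suc ((p + d) + (p + d))
      ∣W∣≤ = begin
        ∣ W ∣                         ≡⟨ ∣p∣≡∣q∣+∣p─q∣ Q⊆W ⟩
        ∣ Q ∣ + ∣ W ─ Q ∣             ≡⟨ cong (_+ ∣ W ─ Q ∣) ∣Q∣≡1+2p ⟩
        suc (p + p) + ∣ W ─ Q ∣       ≤⟨ +-monoʳ-≤ (suc (p + p)) ∣W─Q∣≤ ⟩
        suc (p + p) + (∣ I ∣ + (d + d)) ≡⟨ 1+[p+p]+[a+[d+d]]≡a+1+[p+d+[p+d]] p d ∣ I ∣ ⟩
        ∣ I ∣ + suc ((p + d) + (p + d)) ∎
        where open ≤-Reasoning

  -- This is what the vertex set of a
  -- path on 2p+1 vertices from x to y satisfies.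
  record OddPath (Q : Subset n) (x y : Fin n) (p : ℕ) : Set where
    field
      size     : ∣ Q ∣ ≡ suc (p + p)
      avoiding : ∀ {I} → I ⊆ Q → Independent G I → x ∉ I ⊎ y ∉ I → ∣ I ∣ ≤ p

  oddPath-single : ∀ x → OddPath ⁅ x ⁆ x x 0
  oddPath-single x = record { size = ∣⁅x⁆∣≡1 x ; avoiding = avoiding }
    where
      avoiding : ∀ {I} → I ⊆ ⁅ x ⁆ → Independent G I → x ∉ I ⊎ x ∉ I → ∣ I ∣ ≤ 0
      avoiding {I} I⊆⁅x⁆ _ x∉I⊎x∉I = ≤-reflexive (∣Empty∣≡0 λ (z , z∈I) →
        x∉I (subst (_∈ I) (x∈⁅y⁆⇒x≡y x (I⊆⁅x⁆ z∈I)) z∈I))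
        where
          x∉I : x ∉ I
          x∉I = [ id , id ]′ x∉I⊎x∉I

  -- Dropping x shows α(Q) ≤ p + 1.
  oddPath-α : ∀ {Q x y p} → OddPath Q x y p → AlphaAtMost Q (suc p)
  oddPath-α {Q} {x} path {I} I⊆Q indI =
    split-≤ I ⁅ x ⁆ (∣p∣≤1 (p∩q⊆q I ⁅ x ⁆))
      (avoiding (λ z∈I-x → I⊆Q (p─q⊆p I ⁅ x ⁆ z∈I-x)) (independent-⊆ (p─q⊆p I ⁅ x ⁆) indI)
                (inj₁ λ x∈I-x → x∈p─q⇒x∉q I ⁅ x ⁆ x∈I-x (x∈⁅x⁆ x)))
    where open OddPath path

  oddPath-closed : ∀ {Q x y p} → OddPath Q x y p → adj G x y ≡ true → AlphaAtMost Q p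
  oddPath-closed {x = x} path xy {I} I⊆Q indI with x ∈? I
  ... | no  x∉I = OddPath.avoiding path I⊆Q indI (inj₁ x∉I)
  ... | yes x∈I = OddPath.avoiding path I⊆Q indI (inj₂ (adjacent-excluded indI xy x∈I))

  -- An independent I ⊆ Q ∪ {x, y} missing y (say) has at most one vertex
  -- outside Q, and if it contains x then it misses x′, so its part in Q is ≤ p.
  oddPath-extend : ∀ {Q x′ y′ p x y} → OddPath Q x′ y′ p →
    adj G x′ x ≡ true → adj G y′ y ≡ true → x ≢ y → x ∉ Q → y ∉ Q →
    OddPath (Q ∪ pair x y) x y (suc p)
  oddPath-extend {Q} {x′} {y′} {p} {x} {y} path x′x y′y x≢y x∉Q y∉Q =
    record { size = size′ ; avoiding = avoiding′ }
    where
      open OddPath path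

      size′ : ∣ Q ∪ pair x y ∣ ≡ suc (suc p + suc p)
      size′ = begin
        ∣ Q ∪ pair x y ∣       ≡⟨ ∣p∪q∣≡∣p∣+∣q∣ Q (pair x y)
                                    (Disjoint-∪ (∉⇒Disjoint⁅⁆ x∉Q) (∉⇒Disjoint⁅⁆ y∉Q)) ⟩
        ∣ Q ∣ + ∣ pair x y ∣   ≡⟨ cong₂ _+_ size (∣pair∣≡2 x≢y) ⟩
        suc (p + p) + 2        ≡⟨ 1+[p+p]+2≡1+[1+p+1+p] p ⟩
        suc (suc p + suc p)    ∎
        where open ≡-Reasoning

      outside⊆xy : ∀ {I} → I ⊆ Q ∪ pair x y → I ─ Q ⊆ pair x y
      outside⊆xy {I} I⊆ = ⊆∪-avoidˡ (λ z∈I─Q → I⊆ (p─q⊆p I Q z∈I─Q)) (x∈p─q⇒x∉q I Q)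

      outside-avoids : ∀ {I z} → z ∉ I → Disjoint (I ─ Q) ⁅ z ⁆
      outside-avoids {I} z∉I = ∉⇒Disjoint⁅⁆ (λ z∈I─Q → z∉I (p─q⊆p I Q z∈I─Q))

      inside-avoids : ∀ {I z z′} → Independent G I → adj G z′ z ≡ true → z ∈ I → z′ ∉ I ∩ Q
      inside-avoids {I} indI z′z z∈I z′∈I∩Q = adjacent-excluded indI z′z (p∩q⊆p I Q z′∈I∩Q) z∈I

      avoiding-I∩Q : ∀ {I} → Independent G I → x′ ∉ I ∩ Q ⊎ y′ ∉ I ∩ Q → ∣ I ∩ Q ∣ ≤ p
      avoiding-I∩Q {I} indI = avoiding (p∩q⊆q I Q) (independent-⊆ (p∩q⊆p I Q) indI)

      avoiding′ : ∀ {I} → I ⊆ Q ∪ pair x y → Independent G I → x ∉ I ⊎ y ∉ I → ∣ I ∣ ≤ suc p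
      avoiding′ {I} I⊆ indI miss with x ∈? I | y ∈? I
      ... | yes x∈I | yes y∈I = absurd ([ (λ x∉I → x∉I x∈I) , (λ y∉I → y∉I y∈I) ]′ miss)
      ... | yes x∈I | no  y∉I = ≤-trans
        (split-≤ I Q (avoiding-I∩Q indI (inj₁ (inside-avoids indI x′x x∈I)))
                     (∣p∣≤1 (⊆∪-avoidʳ (outside⊆xy I⊆) (outside-avoids y∉I))))
        (≤-reflexive (+-comm p 1))
      ... | no  x∉I | yes y∈I = ≤-trans
        (split-≤ I Q (avoiding-I∩Q indI (inj₂ (inside-avoids indI y′y y∈I)))
                     (∣p∣≤1 (⊆∪-avoidˡ (outside⊆xy I⊆) (outside-avoids x∉I))))
        (≤-reflexive (+-comm p 1))
      ... | no  x∉I | no  y∉I = ≤-trans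
        (split-≤ I Q (oddPath-α path (p∩q⊆q I Q) (independent-⊆ (p∩q⊆p I Q) indI))
                     (≤-reflexive (∣Empty∣≡0 λ (z , z∈I─Q) →
                       Disjoint-∪ (outside-avoids x∉I) (outside-avoids y∉I) z∈I─Q
                                  (outside⊆xy I⊆ z∈I─Q))))
        (≤-reflexive (+-identityʳ (suc p)))

module BreadthFirst {n : ℕ} (G : Graph n) (W : Subset n) (v : Fin n) (v∈W : v ∈ W) where

  AdjacentFrom : Subset n → Pred (Fin n) 0ℓ
  AdjacentFrom S x = Σ (Fin n) λ y → y ∈ S × adj G y x ≡ true

  adjacentFrom? : ∀ S → Decidable (AdjacentFrom S)
  adjacentFrom? S x = any? (λ y → (y ∈? S) ×-dec (adj G y x ≟ true))

  Neighbours : Subset n → Subset n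
  Neighbours S = ⟦ adjacentFrom? S ⟧

  Layer : ℕ → Subset n
  Ball  : ℕ → Subset n
  Layer zero    = ⁅ v ⁆
  Layer (suc i) = (W ─ Ball i) ∩ Neighbours (Layer i)
  Ball zero     = ⁅ v ⁆
  Ball (suc i)  = Ball i ∪ Layer (suc i)

  Ball⊆W : ∀ i → Ball i ⊆ W
  Ball⊆W zero    = ⁅⁆⊆ v∈W
  Ball⊆W (suc i) = ∪-lub (Ball⊆W i) (λ x∈L → p─q⊆p W (Ball i) (p∩q⊆p (W ─ Ball i) _ x∈L))

  Layer⊆Ball : ∀ i → Layer i ⊆ Ball i
  Layer⊆Ball zero    = id
  Layer⊆Ball (suc i) = q⊆p∪q (Ball i) (Layer (suc i))

  Layer⊆W : ∀ i → Layer i ⊆ W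
  Layer⊆W i x∈L = Ball⊆W i (Layer⊆Ball i x∈L)

  Layer-new : ∀ i → Disjoint (Layer (suc i)) (Ball i)
  Layer-new i x∈L = x∈p─q⇒x∉q W (Ball i) (p∩q⊆p (W ─ Ball i) _ x∈L)

  parent : ∀ {i x} → x ∈ Layer (suc i) → Σ (Fin n) λ y → y ∈ Layer i × adj G y x ≡ true
  parent {i} x∈L = ∈⟦⟧⁻ (adjacentFrom? (Layer i)) (p∩q⊆q (W ─ Ball i) _ x∈L)

  closure : ∀ {i x y} → x ∈ Layer i → y ∈ W → adj G x y ≡ true → y ∈ Ball (suc i)
  closure {i} {x} {y} x∈L y∈W xy with y ∈? Ball i
  ... | yes y∈B = p⊆p∪q (Layer (suc i)) y∈B
  ... | no  y∉B = q⊆p∪q (Ball i) _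
    (x∈p∩q⁺ (x∈p∧x∉q⇒x∈p─q y∈W y∉B , ∈⟦⟧⁺ (adjacentFrom? (Layer i)) (x , x∈L , xy)))

  ∣Ball∣ : ∀ i → ∣ Ball (suc i) ∣ ≡ ∣ Ball i ∣ + ∣ Layer (suc i) ∣
  ∣Ball∣ i = ∣p∪q∣≡∣p∣+∣q∣ (Ball i) (Layer (suc i)) (λ x∈B x∈L → Layer-new i x∈L x∈B)

  v∈Ball : ∀ i → v ∈ Ball i
  v∈Ball zero    = x∈⁅x⁆ v
  v∈Ball (suc i) = p⊆p∪q (Layer (suc i)) (v∈Ball i)

  -- Any two vertices of Layer i are joined by an odd path certificate of
  -- length ≤ 2i+1 inside Ball i, built by following parents back to a common
  -- vertex.
  oddPath-in-layer : ∀ i {x y} → x ∈ Layer i → y ∈ Layer i →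
    Σ (Subset n) λ Q → Σ ℕ λ p → Q ⊆ Ball i × p ≤ i × OddPath G Q x y p
  oddPath-in-layer zero x∈L y∈L with x∈⁅y⁆⇒x≡y v x∈L | x∈⁅y⁆⇒x≡y v y∈L
  ... | refl | refl = ⁅ v ⁆ , 0 , id , z≤n , oddPath-single G v
  oddPath-in-layer (suc i) {x} {y} x∈L y∈L with x ≟ᶠ y
  ... | yes refl = ⁅ x ⁆ , 0 , ⁅⁆⊆ (Layer⊆Ball (suc i) x∈L) , z≤n , oddPath-single G x
  ... | no  x≢y with parent {i} x∈L | parent {i} y∈L
  ... | x′ , x′∈L , x′x | y′ , y′∈L , y′y with oddPath-in-layer i x′∈L y′∈L
  ... | Q , p , Q⊆B , p≤i , path =
    Q ∪ pair x y , suc p ,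
    ∪-lub (λ z∈Q → p⊆p∪q (Layer (suc i)) (Q⊆B z∈Q))
          (pair⊆ (Layer⊆Ball (suc i) x∈L) (Layer⊆Ball (suc i) y∈L)) ,
    s≤s p≤i ,
    oddPath-extend G path x′x y′y x≢y (λ x∈Q → Layer-new i x∈L (Q⊆B x∈Q))
                                      (λ y∈Q → Layer-new i y∈L (Q⊆B y∈Q))

module Greedy {n : ℕ} (G : Graph n) {q k D : ℕ} (k≤q : k ≤ q) (2≤D : 2 ≤ D) where

  Outcome : Subset n → Set
  Outcome W = Σ (Subset n) λ I → I ⊆ W × Independent G I ×
              (D ^ k ≤ ∣ I ∣ ⊎ ∣ W ∣ ≤ (D + D) * ∣ I ∣ + suc (q + q))

  outcome-linear : ∀ {W I} → I ⊆ W → Independent G I → ∣ W ∣ ≤ ∣ I ∣ + suc (q + q) → Outcome W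
  outcome-linear {I = I} I⊆W indI ∣W∣≤ =
    I , I⊆W , indI , inj₂ (≤-trans ∣W∣≤ (+-monoˡ-≤ (suc (q + q)) (m≤[D+D]*m 2≤D ∣ I ∣)))

  peel : ∀ {W L B} → Independent G L → L ⊆ B → B ⊆ W →
         (∀ {x y} → x ∈ L → y ∈ W → adj G x y ≡ true → y ∈ B) →
         ∣ B ∣ ≤ (D + D) * ∣ L ∣ → Outcome (W ─ B) → Outcome W
  peel {W} {L} {B} indL L⊆B B⊆W closed ∣B∣≤ (I , I⊆W─B , indI , result) =
    L ∪ I , ∪-lub (λ x∈L → B⊆W (L⊆B x∈L)) (λ x∈I → p─q⊆p W B (I⊆W─B x∈I)) ,
    independent-∪ G indL indI cross , combine result
    where
      outsideB : ∀ {y} → y ∈ I → y ∉ B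
      outsideB y∈I = x∈p─q⇒x∉q W B (I⊆W─B y∈I)

      cross : ∀ {x y} → x ∈ L → y ∈ I → adj G x y ≡ false
      cross x∈L y∈I = ¬-not λ xy → outsideB y∈I (closed x∈L (p─q⊆p W B (I⊆W─B y∈I)) xy)

      ∣L∪I∣ : ∣ L ∪ I ∣ ≡ ∣ L ∣ + ∣ I ∣
      ∣L∪I∣ = ∣p∪q∣≡∣p∣+∣q∣ L I (λ x∈L x∈I → outsideB x∈I (L⊆B x∈L))

      combine : D ^ k ≤ ∣ I ∣ ⊎ ∣ W ─ B ∣ ≤ (D + D) * ∣ I ∣ + suc (q + q) →
                D ^ k ≤ ∣ L ∪ I ∣ ⊎ ∣ W ∣ ≤ (D + D) * ∣ L ∪ I ∣ + suc (q + q)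
      combine (inj₁ large) = inj₁ (≤-trans large (∣q∣≤∣p∪q∣ L I))
      combine (inj₂ ∣W─B∣≤) = inj₂ (begin
        ∣ W ∣                                               ≡⟨ ∣p∣≡∣q∣+∣p─q∣ B⊆W ⟩
        ∣ B ∣ + ∣ W ─ B ∣                                   ≤⟨ +-mono-≤ ∣B∣≤ ∣W─B∣≤ ⟩
        (D + D) * ∣ L ∣ + ((D + D) * ∣ I ∣ + suc (q + q))   ≡⟨ sym (+-assoc ((D + D) * ∣ L ∣) _ _) ⟩
        (D + D) * ∣ L ∣ + (D + D) * ∣ I ∣ + suc (q + q)
          ≡⟨ cong (_+ suc (q + q)) (sym (*-distribˡ-+ (D + D) ∣ L ∣ ∣ I ∣)) ⟩
        (D + D) * (∣ L ∣ + ∣ I ∣) + suc (q + q)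
          ≡⟨ cong (λ m → (D + D) * m + suc (q + q)) (sym ∣L∪I∣) ⟩
        (D + D) * ∣ L ∪ I ∣ + suc (q + q)                   ∎)
        where open ≤-Reasoning

  module Search (W : Subset n) (v : Fin n) (v∈W : v ∈ W) (P : Local G W (suc (q + q)) (suc q))
                (recurse : ∀ {W′} → W′ ⊆ W → ∣ W′ ∣ < ∣ W ∣ → Outcome W′) where
    open BreadthFirst G W v v∈W

    -- An edge inside Layer i (i ≤ q) closes an odd cycle of length ≤ 2q+1,
    -- and deleting it yields a good outcome.
    independent-layer-or-outcome : ∀ i → i ≤ q → Independent G (Layer i) ⊎ Outcome W
    independent-layer-or-outcome i i≤q with independent-or-edge G (Layer i)
    ... | inj₁ indL = inj₁ indL
    ... | inj₂ (x , y , x∈L , y∈L , xy) with oddPath-in-layer i x∈L y∈L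
    ... | Q , p , Q⊆B , p≤i , path
      with delete-and-match G P (λ z∈Q → Ball⊆W i (Q⊆B z∈Q)) (OddPath.size path)
                                (oddPath-closed G path xy) (≤-trans p≤i i≤q)
    ... | I , I⊆W , indI , ∣W∣≤ = inj₂ (outcome-linear I⊆W indI ∣W∣≤)

    stop : ∀ i → i ≤ q → ∣ Layer (suc i) ∣ ≤ D * ∣ Layer i ∣ →
           ∣ Ball i ∣ ≤ ∣ Layer i ∣ + ∣ Layer i ∣ → Outcome W
    stop i i≤q sparse ∣B∣≤ with independent-layer-or-outcome i i≤q
    ... | inj₂ outcome = outcome
    ... | inj₁ indL =
      peel indL (λ x∈L → p⊆p∪q (Layer (suc i)) (Layer⊆Ball i x∈L)) (Ball⊆W (suc i)) (closure {i})
           ∣B′∣≤ (recurse (p─q⊆p W (Ball (suc i))) shrinks)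
      where
        ∣B′∣≤ : ∣ Ball (suc i) ∣ ≤ (D + D) * ∣ Layer i ∣
        ∣B′∣≤ = begin
          ∣ Ball (suc i) ∣                        ≡⟨ ∣Ball∣ i ⟩
          ∣ Ball i ∣ + ∣ Layer (suc i) ∣          ≤⟨ +-mono-≤ (≤-trans ∣B∣≤ (m+m≤D*m 2≤D _)) sparse ⟩
          D * ∣ Layer i ∣ + D * ∣ Layer i ∣       ≡⟨ sym (*-distribʳ-+ ∣ Layer i ∣ D D) ⟩
          (D + D) * ∣ Layer i ∣                   ∎
          where open ≤-Reasoning
        shrinks : ∣ W ─ Ball (suc i) ∣ < ∣ W ∣
        shrinks = p∩q≢∅⇒∣p─q∣<∣p∣ W (Ball (suc i)) (v , x∈p∩q⁺ (v∈W , v∈Ball (suc i)))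

    -- Main loop, j steps before reaching layer k.  Invariants:
    -- ∣Layer i∣ ≥ D^i and ∣Ball i∣ ≤ 2 ∣Layer i∣ (layers grow by factor > D ≥ 2).
    grow : ∀ j i → j + i ≡ k → D ^ i ≤ ∣ Layer i ∣ →
           ∣ Ball i ∣ ≤ ∣ Layer i ∣ + ∣ Layer i ∣ → Outcome W
    grow zero i refl large ∣B∣≤ with independent-layer-or-outcome i k≤q
    ... | inj₁ indL    = Layer i , Layer⊆W i , indL , inj₁ large
    ... | inj₂ outcome = outcome
    grow (suc j) i j+i≡k large ∣B∣≤ with ∣ Layer (suc i) ∣ ≤? D * ∣ Layer i ∣
    ... | yes sparse = stop i (≤-trans (m≤n+m i (suc j)) (≤-trans (≤-reflexive j+i≡k) k≤q)) sparse ∣B∣≤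
    ... | no  dense  = grow j (suc i) (trans (+-suc j i) j+i≡k) large′ ∣B′∣≤
      where
        D*L<L′ : D * ∣ Layer i ∣ < ∣ Layer (suc i) ∣
        D*L<L′ = ≰⇒> dense
        large′ : D ^ suc i ≤ ∣ Layer (suc i) ∣
        large′ = ≤-trans (*-monoʳ-≤ D large) (<⇒≤ D*L<L′)
        ∣B′∣≤ : ∣ Ball (suc i) ∣ ≤ ∣ Layer (suc i) ∣ + ∣ Layer (suc i) ∣
        ∣B′∣≤ = begin
          ∣ Ball (suc i) ∣                    ≡⟨ ∣Ball∣ i ⟩
          ∣ Ball i ∣ + ∣ Layer (suc i) ∣
            ≤⟨ +-monoˡ-≤ _ (≤-trans ∣B∣≤ (≤-trans (m+m≤D*m 2≤D _) (<⇒≤ D*L<L′))) ⟩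
          ∣ Layer (suc i) ∣ + ∣ Layer (suc i) ∣ ∎
          where open ≤-Reasoning

  greedy : ∀ W → Local G W (suc (q + q)) (suc q) → Outcome W
  greedy W = <-rec Goal step ∣ W ∣ W refl
    where
      Goal : ℕ → Set
      Goal N = ∀ W → ∣ W ∣ ≡ N → Local G W (suc (q + q)) (suc q) → Outcome W

      step : ∀ N → (∀ {M} → M < N → Goal M) → Goal N
      step _ recurse W refl P with nonempty? W
      ... | no  empty = ⊥ , ⊆-min W , independent-⊥ G ,
                        inj₂ (≤-trans (≤-reflexive (∣Empty∣≡0 empty)) z≤n)
      ... | yes (v , v∈W) =
        Search.grow W v v∈W P (λ {W′} W′⊆W ∣W′∣<∣W∣ → recurse ∣W′∣<∣W∣ W′ refl (local-⊆ G W′⊆W P))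
                    k 0 (+-identityʳ k) (≤-reflexive (sym (∣⁅x⁆∣≡1 v))) (m≤m+n _ _)

^-distribʳ-* : ∀ a b k → (a * b) ^ k ≡ a ^ k * b ^ k
^-distribʳ-* a b zero    = refl
^-distribʳ-* a b (suc k) = trans (cong ((a * b) *_) (^-distribʳ-* a b k)) (swap a b (a ^ k) (b ^ k))
  where
    swap : ∀ a b x y → a * b * (x * y) ≡ a * x * (b * y)
    swap = solve-∀

m≤n+h⇒m≤[1+h]*n : ∀ {m n} h → m ≤ n + h → 1 ≤ n → m ≤ suc h * n
m≤n+h⇒m≤[1+h]*n {m} {n} h m≤n+h 1≤n =
  ≤-trans m≤n+h (+-monoʳ-≤ n (≤-trans (≤-reflexive (sym (*-identityʳ h))) (*-monoʳ-≤ h 1≤n)))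

root : ∀ k N → Σ ℕ λ D → D ^ suc k ≤ N × N < suc D ^ suc k
root k zero    = 0 , z≤n , ≤-reflexive (sym (^-zeroˡ (suc k)))
root k (suc N) with root k N
... | D , D^e≤N , N<[1+D]^e with suc N <? suc D ^ suc k
... | yes N+1<[1+D]^e = D , m≤n⇒m≤1+n D^e≤N , N+1<[1+D]^e
... | no  N+1≮[1+D]^e = suc D , ≮⇒≥ N+1≮[1+D]^e , ≤-<-trans N<[1+D]^e (^-monoˡ-< (suc k) (n<1+n (suc D)))

large-layer-bound : ∀ {N D a} k → N < suc D ^ suc k → 1 ≤ D → D ^ k ≤ a →
                    N ^ k ≤ (2 ^ k) ^ suc k * a ^ suc k
large-layer-bound {N} {D} {a} k N<[1+D]^e 1≤D D^k≤a = begin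
  N ^ k                      ≤⟨ ^-monoˡ-≤ k (<⇒≤ N<[1+D]^e) ⟩
  (suc D ^ suc k) ^ k        ≡⟨ ^-*-assoc (suc D) (suc k) k ⟩
  suc D ^ (suc k * k)        ≡⟨ cong (suc D ^_) (*-comm (suc k) k) ⟩
  suc D ^ (k * suc k)        ≡⟨ sym (^-*-assoc (suc D) k (suc k)) ⟩
  (suc D ^ k) ^ suc k        ≤⟨ ^-monoˡ-≤ (suc k) (^-monoˡ-≤ k 1+D≤2*D) ⟩
  ((2 * D) ^ k) ^ suc k      ≡⟨ cong (_^ suc k) (^-distribʳ-* 2 D k) ⟩
  (2 ^ k * D ^ k) ^ suc k    ≤⟨ ^-monoˡ-≤ (suc k) (*-monoʳ-≤ (2 ^ k) D^k≤a) ⟩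
  (2 ^ k * a) ^ suc k        ≡⟨ ^-distribʳ-* (2 ^ k) a (suc k) ⟩
  (2 ^ k) ^ suc k * a ^ suc k ∎
  where
    open ≤-Reasoning
    1+D≤2*D : suc D ≤ 2 * D
    1+D≤2*D = ≤-trans (+-monoˡ-≤ D 1≤D) (≤-reflexive (cong (D +_) (sym (+-identityʳ D))))

proportional-bound : ∀ {N D a} k → D ^ suc k ≤ N → 1 ≤ N → N ≤ 4 * D * a →
                     N ^ k ≤ 4 ^ suc k * a ^ suc k
proportional-bound {N} {D} {a} k D^e≤N 1≤N N≤4Da = *-cancelˡ-≤ N {{>-nonZero 1≤N}} (begin
  N * N ^ k                        ≤⟨ ^-monoˡ-≤ (suc k) N≤4Da ⟩
  (4 * D * a) ^ suc k              ≡⟨ ^-distribʳ-* (4 * D) a (suc k) ⟩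
  (4 * D) ^ suc k * a ^ suc k      ≡⟨ cong (_* a ^ suc k) (^-distribʳ-* 4 D (suc k)) ⟩
  4 ^ suc k * D ^ suc k * a ^ suc k ≤⟨ *-monoˡ-≤ (a ^ suc k) (*-monoʳ-≤ (4 ^ suc k) D^e≤N) ⟩
  4 ^ suc k * N * a ^ suc k        ≡⟨ rearrange (4 ^ suc k) N (a ^ suc k) ⟩
  N * (4 ^ suc k * a ^ suc k)      ∎)
  where
    open ≤-Reasoning
    rearrange : ∀ x y z → x * y * z ≡ y * (x * z)
    rearrange = solve-∀

linear⇒proportional : ∀ {N X c} → N ≤ X + c → ¬ N ≤ c + c → N ≤ X + X
linear⇒proportional {N} {X} {c} N≤X+c N≰2c with N ≤? X + X
... | yes N≤2X = N≤2X
... | no  N≰2X = absurd (≤⇒≯ 2N≤2X+2c (+-mono-< (≰⇒> N≰2X) (≰⇒> N≰2c)))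
  where
    2N≤2X+2c : N + N ≤ (X + X) + (c + c)
    2N≤2X+2c = ≤-trans (+-mono-≤ N≤X+c N≤X+c) (≤-reflexive (regroup X c))
      where
        regroup : ∀ x c → (x + c) + (x + c) ≡ (x + x) + (c + c)
        regroup = solve-∀

module _ {n : ℕ} (G : Graph n) where

  Bound : ℕ → ℕ → Subset n → Set
  Bound K k W = Σ (Subset n) λ I → I ⊆ W × Independent G I × ∣ W ∣ ^ k ≤ K * ∣ I ∣ ^ suc k

  bound-mono : ∀ {K K′ k W} → K ≤ K′ → Bound K k W → Bound K′ k W
  bound-mono {k = k} K≤K′ (I , I⊆W , indI , bound) =
    I , I⊆W , indI , ≤-trans bound (*-monoˡ-≤ (∣ I ∣ ^ suc k) K≤K′)

  -- Sets of size ≤ c satisfy the bound with K = c^k, witnessed by a single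
  -- vertex (k ≥ 1 handles the empty set).
  bound-small : ∀ {k c} W → 1 ≤ k → ∣ W ∣ ≤ c → Bound (c ^ k) k W
  bound-small {suc k} {c} W (s≤s z≤n) ∣W∣≤c with nonempty? W
  ... | no  empty =
    ⊥ , ⊆-min W , independent-⊥ G , subst (λ m → m ^ suc k ≤ _) (sym (∣Empty∣≡0 empty)) z≤n
  ... | yes (v , v∈W) = ⁅ v ⁆ , ⁅⁆⊆ v∈W , independent-⁅⁆ G v , (begin
    ∣ W ∣ ^ suc k                       ≤⟨ ^-monoˡ-≤ (suc k) ∣W∣≤c ⟩
    c ^ suc k                           ≡⟨ sym (*-identityʳ (c ^ suc k)) ⟩
    c ^ suc k * 1                       ≡⟨ cong (c ^ suc k *_) (sym (^-zeroˡ (suc (suc k)))) ⟩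
    c ^ suc k * 1 ^ suc (suc k)         ≡⟨ cong (λ m → c ^ suc k * m ^ suc (suc k)) (sym (∣⁅x⁆∣≡1 v)) ⟩
    c ^ suc k * ∣ ⁅ v ⁆ ∣ ^ suc (suc k) ∎)
    where open ≤-Reasoning

  bound-lift : ∀ {K k h W W′} → 1 ≤ k → W′ ⊆ W → ∣ W ∣ ≤ ∣ W′ ∣ + h →
               Bound K k W′ → Bound (K * suc h ^ k + h ^ k) k W
  bound-lift {K} {k} {h} {W} {W′} 1≤k W′⊆W ∣W∣≤ (I , I⊆W′ , indI , bound) with ∣ W′ ∣ ≟ℕ 0
  ... | yes ∣W′∣≡0 =
    bound-mono {k = k} (m≤n+m (h ^ k) (K * suc h ^ k))
      (bound-small W 1≤k (subst (λ m → ∣ W ∣ ≤ m + h) ∣W′∣≡0 ∣W∣≤))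
  ... | no  ∣W′∣≢0 = I , (λ x∈I → W′⊆W (I⊆W′ x∈I)) , indI , (begin
    ∣ W ∣ ^ k                             ≤⟨ ^-monoˡ-≤ k (m≤n+h⇒m≤[1+h]*n h ∣W∣≤ (n≢0⇒n>0 ∣W′∣≢0)) ⟩
    (suc h * ∣ W′ ∣) ^ k                  ≡⟨ ^-distribʳ-* (suc h) ∣ W′ ∣ k ⟩
    suc h ^ k * ∣ W′ ∣ ^ k                ≤⟨ *-monoʳ-≤ (suc h ^ k) bound ⟩
    suc h ^ k * (K * ∣ I ∣ ^ suc k)       ≡⟨ rearrange (suc h ^ k) K (∣ I ∣ ^ suc k) ⟩
    K * suc h ^ k * ∣ I ∣ ^ suc k         ≤⟨ *-monoˡ-≤ (∣ I ∣ ^ suc k) (m≤m+n (K * suc h ^ k) (h ^ k)) ⟩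
    (K * suc h ^ k + h ^ k) * ∣ I ∣ ^ suc k ∎)
    where
      open ≤-Reasoning
      rearrange : ∀ a b c → a * (b * c) ≡ b * a * c
      rearrange = solve-∀

record LocalBound (m r k : ℕ) : Set where
  field
    K     : ℕ
    K>0   : 0 < K
    bound : ∀ {n} (G : Graph n) W → Local G W m r → Bound G K k W

-- Case t = 1: (2q+1, q+1)-local sets, 1 ≤ k ≤ q.  With D the integer
-- (k+1)-th root of N = ∣W∣, the greedy outcome gives the bound; sets with
-- D < 2 or N ≤ 2(2q+1) are covered by bound-small.
base-case : ∀ q k → 1 ≤ k → k ≤ q → LocalBound (suc (q + q)) (suc q) k
base-case q k 1≤k k≤q = record { K = K ; K>0 = ≤-trans (m^n>0 4 (suc k)) B≤K ; bound = bound }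
  where
    c = suc (q + q)
    S = 2 ^ suc k + (c + c)
    A = (2 ^ k) ^ suc k
    B = 4 ^ suc k
    K = A + B + S ^ k

    A≤K : A ≤ K
    A≤K = ≤-trans (m≤m+n A B) (m≤m+n (A + B) (S ^ k))
    B≤K : B ≤ K
    B≤K = ≤-trans (m≤n+m B A) (m≤m+n (A + B) (S ^ k))
    S^k≤K : S ^ k ≤ K
    S^k≤K = m≤n+m (S ^ k) (A + B)

    bound : ∀ {n} (G : Graph n) W → Local G W c (suc q) → Bound G K k W
    bound G W P with root k ∣ W ∣
    ... | D , D^e≤N , N<[1+D]^e with 2 ≤? D
    ... | no  D≱2 = bound-mono G {k = k} S^k≤K (bound-small G W 1≤k N≤S)
      where
        N≤S : ∣ W ∣ ≤ S
        N≤S = ≤-trans (<⇒≤ (<-≤-trans N<[1+D]^e (^-monoˡ-≤ (suc k) (≰⇒> D≱2)))) (m≤m+n _ _)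
    ... | yes 2≤D with Greedy.greedy G k≤q 2≤D W P
    ... | I , I⊆W , indI , inj₁ D^k≤∣I∣ =
      I , I⊆W , indI ,
      ≤-trans (large-layer-bound k N<[1+D]^e (≤-trans (s≤s z≤n) 2≤D) D^k≤∣I∣) (*-monoˡ-≤ _ A≤K)
    ... | I , I⊆W , indI , inj₂ ∣W∣≤ with ∣ W ∣ ≤? c + c
    ...   | yes N≤2c = bound-mono G {k = k} S^k≤K (bound-small G W 1≤k (≤-trans N≤2c (m≤n+m _ _)))
    ...   | no  N≰2c =
      I , I⊆W , indI ,
      ≤-trans (proportional-bound {D = D} {a = ∣ I ∣} k D^e≤N (≤-trans (s≤s z≤n) (≰⇒> N≰2c)) N≤4Da)
              (*-monoˡ-≤ _ B≤K)
      where
        double : ∀ D a → (D + D) * a + (D + D) * a ≡ 4 * D * a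
        double = solve-∀
        N≤4Da : ∣ W ∣ ≤ 4 * D * ∣ I ∣
        N≤4Da = ≤-trans (linear⇒proportional {X = (D + D) * ∣ I ∣} {c = c} ∣W∣≤ N≰2c)
                        (≤-reflexive (double D ∣ I ∣))

-- Induction on t, where the argument t of local-bound is the paper's t minus
-- one: (t+2q+1, q+1)-local sets with k (t+1) ≤ q.  Write q = k + j and
-- h = t + 2j; either W contains an h-set H with α(H) ≤ j, and W ─ H is
-- (2k+1, k+1)-local, or W is (h, j+1)-local.
local-bound : ∀ t q k → 1 ≤ k → k * suc t ≤ q → LocalBound (suc t + (q + q)) (suc q) k
local-bound zero    q k 1≤k k≤q = base-case q k 1≤k (subst (_≤ q) (*-identityʳ k) k≤q)
local-bound (suc t) q k 1≤k k[2+t]≤q with m≤n⇒∃[o]m+o≡n (≤-trans (m≤m*n k (suc (suc t))) k[2+t]≤q)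
... | j , refl = record
  { K     = K₁ + K₂
  ; K>0   = ≤-trans K₂>0 (m≤n+m K₂ K₁)
  ; bound = bound
  }
  where
    k[1+t]≤j : k * suc t ≤ j
    k[1+t]≤j = +-cancelˡ-≤ k _ _ (≤-trans (≤-reflexive (sym (*-suc k (suc t)))) k[2+t]≤q)

    module Base = LocalBound (base-case k k 1≤k ≤-refl)
    module Rest = LocalBound (local-bound t j k 1≤k k[1+t]≤j)
    open Rest using () renaming (K to K₂; K>0 to K₂>0)

    h = suc t + (j + j)
    K₁ = Base.K * suc h ^ k + h ^ k

    bound : ∀ {n} (G : Graph n) W → Local G W (suc (suc t) + ((k + j) + (k + j))) (suc (k + j)) →
            Bound G (K₁ + K₂) k W
    bound G W P with sparse-set-or-local G W h j
    ... | inj₂ P′ = bound-mono G {k = k} (m≤n+m K₂ K₁) (Rest.bound G W P′)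
    ... | inj₁ (H , H⊆W , ∣H∣≡h , αH≤j) =
      bound-mono G {k = k} (m≤m+n K₁ K₂)
        (bound-lift G {K = Base.K} 1≤k (p─q⊆p W H) ∣W∣≤
          (Base.bound G (W ─ H) (local-─ G P′ H⊆W ∣H∣≡h αH≤j)))
      where
        P′ : Local G W (h + suc (k + k)) (j + suc k)
        P′ = subst₂ (Local G W) (2+t+[2[k+j]]≡1+t+2j+[1+2k] t k j) (1+[k+j]≡j+[1+k] k j) P
        ∣W∣≤ : ∣ W ∣ ≤ ∣ W ─ H ∣ + h
        ∣W∣≤ = ≤-reflexive (trans (∣p∣≡∣q∣+∣p─q∣ H⊆W) (trans (cong (_+ ∣ W ─ H ∣) ∣H∣≡h) (+-comm h _)))

local-⊤ : ∀ {n} (G : Graph n) {m r} → LocalαAtLeast G m r → Local G ⊤ m r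
local-⊤ G hyp {S} _ ∣S∣≡m with hyp S ∣S∣≡m
... | I , I⊆S , indI , ∣I∣≡r = I , I⊆S , indI , ≤-reflexive (sym ∣I∣≡r)

proposition1p1 : ∀ (r t : ℕ) → 2 ≤ r → 1 ≤ t → t ≤ r ∸ 1 →
    Σ ℕ λ K → 0 < K ×
      (∀ (n : ℕ) (G : Graph n) → LocalαAtLeast G (2 * r ∸ 2 + t) r →
        Σ (Subset n) λ I → Independent G I × n ^ (ell r t ∸ 1) ≤ K * ∣ I ∣ ^ ell r t)
proposition1p1 (suc q) (suc t) (s≤s (s≤s _)) (s≤s z≤n) 1+t≤q = K , K>0 , independent-set
  where
    k = q / suc t
    open LocalBound (local-bound t q k (m≥n⇒m/n>0 1+t≤q) (m/n*n≤m q (suc t)))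

    m≡ : 2 * suc q ∸ 2 + suc t ≡ suc t + (q + q)
    m≡ = trans (cong (λ a → a ∸ 2 + suc t) (2*[1+q]≡2+[q+q] q)) (+-comm (q + q) (suc t))

    independent-set : ∀ n (G : Graph n) → LocalαAtLeast G (2 * suc q ∸ 2 + suc t) (suc q) →
      Σ (Subset n) λ I → Independent G I × n ^ (k + 1 ∸ 1) ≤ K * ∣ I ∣ ^ (k + 1)
    independent-set n G hyp with bound G ⊤ (subst (λ m → Local G ⊤ m (suc q)) m≡ (local-⊤ G hyp))
    ... | I , _ , indI , ∣⊤∣^k≤ =
      I , indI , subst₂ (λ a b → a ≤ K * ∣ I ∣ ^ b)
                        (cong₂ _^_ (∣⊤∣≡n n) (sym (m+n∸n≡m k 1))) (+-comm 1 k) ∣⊤∣^k≤
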